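{- If $G$ is an elongated triangular prism graph with exactly 11 vertices, then the complement $\overline{G}$ contains $K_7$ as a minor.
   Context: The triangular prism graph has vertices $u_A,u_B,u_C,w_A,w_B,w_C$ and edges forming the two triangles $u_Au_Bu_C$ and $w_Aw_Bw_C$ together with the three edges $(u_A,w_A),(u_B,w_B),(u_C,w_C)$. An elongated triangular prism graph is any graph obtained from the triangular prism graph by subdividing (any number of times, possibly zero, independently for each) the edges $(u_A,w_A)$, $(u_B,w_B)$, $(u_C,w_C)$, i.e. replacing each of them by a path. The complement $\overline{G}$ has the same vertex set as $G$, with two distinct vertices adjacent iff they are not adjacent in $G$. Minors are obtained by vertex deletions, edge deletions and edge contractions. -}

module Defs where

open import Level using (0ℓ)
open import Data.Nat using (ℕ; zero; suc; _+_)
open import Data.Fin using (Fin; toℕ; punchIn)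
open import Data.Product using (_×_; _,_; Σ)
open import Data.Sum using (_⊎_)
open import Data.List using (List; []; _∷_; _++_)
open import Data.List.Membership.Propositional using (_∈_)
open import Relation.Nullary using (¬_)
open import Relation.Binary.PropositionalEquality using (_≡_; _≢_)

-- A graph on the vertex set Fin n, given by its adjacency relation.
-- (All graphs built below are simple: symmetric and loopless.)
Graph : ℕ → Set₁
Graph n = Fin n → Fin n → Set

complement : ∀ {n} → Graph n → Graph n
complement G x y = x ≢ y × ¬ G x y

K : (n : ℕ) → Graph n
K n x y = x ≢ y

record _≅_ {m n : ℕ} (G : Graph m) (H : Graph n) : Set where
  field
    to      : Fin m → Fin n
    from    : Fin n → Fin m
    from-to : ∀ x → from (to x) ≡ x
    to-from : ∀ y → to (from y) ≡ y
    pres    : ∀ x y → G x y → H (to x) (to y)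
    refl'   : ∀ x y → H (to x) (to y) → G x y

deleteVertex : ∀ {n} → Graph (suc n) → Fin (suc n) → Graph n
deleteVertex G v i j = G (punchIn v i) (punchIn v j)

deleteEdge : ∀ {n} → Graph n → Fin n → Fin n → Graph n
deleteEdge G u v x y = G x y × ¬ (x ≡ u × y ≡ v) × ¬ (x ≡ v × y ≡ u)

-- Contracting the edge {u,v}: v is merged into u (v disappears, u inherits
-- v's neighbours), giving again a simple graph.
contract : ∀ {n} → Graph (suc n) → Fin (suc n) → Fin (suc n) → Graph n
contract G u v i j =
  i ≢ j × (G a b ⊎ (a ≡ u × G v b) ⊎ (b ≡ u × G a v))
  where
    a = punchIn v i
    b = punchIn v j

data _≼_ {m : ℕ} (H : Graph m) : {n : ℕ} → Graph n → Set₁ where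
  iso     : ∀ {n} {G : Graph n} → G ≅ H → H ≼ G
  delV    : ∀ {n} {G : Graph (suc n)} (v : Fin (suc n)) →
            H ≼ deleteVertex G v → H ≼ G
  delE    : ∀ {n} {G : Graph n} (u v : Fin n) → G u v →
            H ≼ deleteEdge G u v → H ≼ G
  contr   : ∀ {n} {G : Graph (suc n)} (u v : Fin (suc n)) → u ≢ v → G u v →
            H ≼ contract G u v → H ≼ G

pathEdges : ℕ → ℕ → ℕ → ℕ → List (ℕ × ℕ)
pathEdges s i zero    e = (s , e) ∷ []
pathEdges s i (suc k) e = (s , i) ∷ pathEdges i (suc i) k e

-- Elongated triangular prism with a, b, c subdivision vertices on the
-- three connecting edges.  Labels: 0,1,2 = u_A,u_B,u_C; 3,4,5 = w_A,w_B,w_C;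
-- 6.. = subdivision vertices.
prismEdges : ℕ → ℕ → ℕ → List (ℕ × ℕ)
prismEdges a b c =
  (0 , 1) ∷ (1 , 2) ∷ (0 , 2) ∷ (3 , 4) ∷ (4 , 5) ∷ (3 , 5) ∷
  (pathEdges 0 6 a 3 ++ pathEdges 1 (6 + a) b 4 ++ pathEdges 2 (6 + a + b) c 5)

ElongatedPrism : (a b c : ℕ) → Graph (6 + a + b + c)
ElongatedPrism a b c x y =
  (toℕ x , toℕ y) ∈ prismEdges a b c ⊎ (toℕ y , toℕ x) ∈ prismEdges a b c

IsElongatedPrism : ∀ {n} → Graph n → Set
IsElongatedPrism G = Σ ℕ λ a → Σ ℕ λ b → Σ ℕ λ c → ElongatedPrism a b c ≅ G

{-# OPTIONS --safe #-}
-- An elongated prism on 11 vertices has a + b + c = 5 subdivision vertices, so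
-- there are only 21 graphs to consider.  For each, the complement contains K₇ as
-- a minor via four vertex deletions and edge contractions; the sequence is
-- verified by evaluation.  Minors are invariant under isomorphism, which
-- carries the result from the concrete prism to any isomorphic G.
module Submission where

open import Defs
open import Data.Nat using (ℕ; suc; _+_)
open import Data.Fin using (Fin; #_; punchIn; punchOut)
open import Data.Fin.Properties
  using (punchIn-injective; punchInᵢ≢i; punchIn-punchOut; all?; cantor-schröder-bernstein)
  renaming (_≟_ to _≟ᶠ_)
open import Data.Nat.Properties using () renaming (_≟_ to _≟ℕ_)
open import Data.Product using (_×_; _,_; proj₁; proj₂)
open import Data.Product.Properties using (≡-dec)
open import Data.Sum using (inj₁; inj₂)
open import Data.List.Membership.DecPropositional (≡-dec _≟ℕ_ _≟ℕ_) using (_∈?_)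
open import Relation.Nullary using (Dec)
open import Relation.Nullary.Decidable using (True; toWitness; ¬?; _×-dec_; _→-dec_; _⊎-dec_)
open import Relation.Binary.Definitions using (Decidable)
open import Relation.Binary.PropositionalEquality using (_≡_; _≢_; refl; sym; trans; cong; subst₂)

open _≅_

module _ {m n} {G : Graph m} {H : Graph n} (φ : G ≅ H) where

  to-injective : ∀ {x y} → to φ x ≡ to φ y → x ≡ y
  to-injective {x} {y} e = trans (sym (from-to φ x)) (trans (cong (from φ) e) (from-to φ y))

  from-injective : ∀ {x y} → from φ x ≡ from φ y → x ≡ y
  from-injective {x} {y} e = trans (sym (to-from φ x)) (trans (cong (to φ) e) (to-from φ y))

  pres-at : ∀ {x y x′ y′} → x′ ≡ to φ x → y′ ≡ to φ y → G x y → H x′ y′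
  pres-at {x} {y} ex ey g = subst₂ H (sym ex) (sym ey) (pres φ x y g)

  refl-at : ∀ {x y x′ y′} → x′ ≡ to φ x → y′ ≡ to φ y → H x′ y′ → G x y
  refl-at {x} {y} ex ey h = refl' φ x y (subst₂ H ex ey h)

  ≅-sym : H ≅ G
  ≅-sym = record
    { to = from φ ; from = to φ ; from-to = to-from φ ; to-from = from-to φ
    ; pres = λ x y h → refl-at (sym (to-from φ x)) (sym (to-from φ y)) h
    ; refl' = λ x y g → pres-at (sym (to-from φ x)) (sym (to-from φ y)) g
    }

≅-trans : ∀ {l m n} {A : Graph l} {B : Graph m} {C : Graph n} → A ≅ B → B ≅ C → A ≅ C
≅-trans φ ψ = record
  { to = λ x → to ψ (to φ x) ; from = λ z → from φ (from ψ z)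
  ; from-to = λ x → trans (cong (from φ) (from-to ψ _)) (from-to φ x)
  ; to-from = λ z → trans (cong (to ψ) (to-from φ _)) (to-from ψ z)
  ; pres = λ x y a → pres ψ _ _ (pres φ _ _ a)
  ; refl' = λ x y c → refl' φ _ _ (refl' ψ _ _ c)
  }

module _ {n} {G H : Graph n} (φ : G ≅ H) where

  complement-≅ : complement G ≅ complement H
  complement-≅ = record
    { to = to φ ; from = from φ ; from-to = from-to φ ; to-from = to-from φ
    ; pres = λ x y (x≢y , ¬g) → (λ e → x≢y (to-injective φ e)) , (λ h → ¬g (refl' φ x y h))
    ; refl' = λ x y (x≢y , ¬h) → (λ e → x≢y (cong (to φ) e)) , (λ g → ¬h (pres φ x y g))
    }

  deleteEdge-≅ : ∀ u v → deleteEdge G u v ≅ deleteEdge H (to φ u) (to φ v)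
  deleteEdge-≅ u v = record
    { to = to φ ; from = from φ ; from-to = from-to φ ; to-from = to-from φ
    ; pres = λ x y (g , ¬uv , ¬vu) → pres φ x y g
        , (λ (ex , ey) → ¬uv (to-injective φ ex , to-injective φ ey))
        , (λ (ex , ey) → ¬vu (to-injective φ ex , to-injective φ ey))
    ; refl' = λ x y (h , ¬uv , ¬vu) → refl' φ x y h
        , (λ (ex , ey) → ¬uv (cong (to φ) ex , cong (to φ) ey))
        , (λ (ex , ey) → ¬vu (cong (to φ) ex , cong (to φ) ey))
    }

module _ {n} {G H : Graph (suc n)} (φ : G ≅ H) (v : Fin (suc n)) where

  punchedTo : Fin n → Fin n
  punchedTo i = punchOut {i = to φ v} {j = to φ (punchIn v i)}
    (λ e → punchInᵢ≢i v i (to-injective φ (sym e)))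

  punchedFrom : Fin n → Fin n
  punchedFrom j = punchOut {i = v} {j = from φ (punchIn (to φ v) j)}
    (λ e → punchInᵢ≢i (to φ v) j (trans (sym (to-from φ _)) (cong (to φ) (sym e))))

  punchIn-punchedTo : ∀ i → punchIn (to φ v) (punchedTo i) ≡ to φ (punchIn v i)
  punchIn-punchedTo i = punchIn-punchOut _

  punchIn-punchedFrom : ∀ j → punchIn v (punchedFrom j) ≡ from φ (punchIn (to φ v) j)
  punchIn-punchedFrom j = punchIn-punchOut _

  punchedFrom-punchedTo : ∀ i → punchedFrom (punchedTo i) ≡ i
  punchedFrom-punchedTo i = punchIn-injective v _ _
    (trans (punchIn-punchedFrom (punchedTo i))
      (trans (cong (from φ) (punchIn-punchedTo i)) (from-to φ _)))

  punchedTo-punchedFrom : ∀ j → punchedTo (punchedFrom j) ≡ j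
  punchedTo-punchedFrom j = punchIn-injective (to φ v) _ _
    (trans (punchIn-punchedTo (punchedFrom j))
      (trans (cong (to φ) (punchIn-punchedFrom j)) (to-from φ _)))

  punchedTo-injective : ∀ {i j} → punchedTo i ≡ punchedTo j → i ≡ j
  punchedTo-injective {i} {j} e =
    trans (sym (punchedFrom-punchedTo i)) (trans (cong punchedFrom e) (punchedFrom-punchedTo j))

  punchedTo-≢ : ∀ {i j} → i ≢ j → punchedTo i ≢ punchedTo j
  punchedTo-≢ i≢j e = i≢j (punchedTo-injective e)

  deleteVertex-≅ : deleteVertex G v ≅ deleteVertex H (to φ v)
  deleteVertex-≅ = record
    { to = punchedTo ; from = punchedFrom
    ; from-to = punchedFrom-punchedTo ; to-from = punchedTo-punchedFrom
    ; pres = λ x y → pres-at φ (punchIn-punchedTo x) (punchIn-punchedTo y)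
    ; refl' = λ x y → refl-at φ (punchIn-punchedTo x) (punchIn-punchedTo y)
    }

  contract-≅ : ∀ u → contract G u v ≅ contract H (to φ u) (to φ v)
  contract-≅ u = record
    { to = punchedTo ; from = punchedFrom
    ; from-to = punchedFrom-punchedTo ; to-from = punchedTo-punchedFrom
    ; pres = λ _ _ → forward
    ; refl' = λ _ _ → backward
    }
    where
    forward : ∀ {x y} → contract G u v x y → contract H (to φ u) (to φ v) (punchedTo x) (punchedTo y)
    forward {x} {y} (x≢y , inj₁ g) =
      punchedTo-≢ x≢y , inj₁ (pres-at φ (punchIn-punchedTo x) (punchIn-punchedTo y) g)
    forward {x} {y} (x≢y , inj₂ (inj₁ (e , g))) =
      punchedTo-≢ x≢y , inj₂ (inj₁ (trans (punchIn-punchedTo x) (cong (to φ) e) , pres-at φ refl (punchIn-punchedTo y) g))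
    forward {x} {y} (x≢y , inj₂ (inj₂ (e , g))) =
      punchedTo-≢ x≢y , inj₂ (inj₂ (trans (punchIn-punchedTo y) (cong (to φ) e) , pres-at φ (punchIn-punchedTo x) refl g))

    backward : ∀ {x y} → contract H (to φ u) (to φ v) (punchedTo x) (punchedTo y) → contract G u v x y
    backward {x} {y} (x≢y , inj₁ h) =
      (λ e → x≢y (cong punchedTo e)) , inj₁ (refl-at φ (punchIn-punchedTo x) (punchIn-punchedTo y) h)
    backward {x} {y} (x≢y , inj₂ (inj₁ (e , h))) =
      (λ e → x≢y (cong punchedTo e)) ,
      inj₂ (inj₁ (to-injective φ (trans (sym (punchIn-punchedTo x)) e) , refl-at φ refl (punchIn-punchedTo y) h))
    backward {x} {y} (x≢y , inj₂ (inj₂ (e , h))) =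
      (λ e → x≢y (cong punchedTo e)) ,
      inj₂ (inj₂ (to-injective φ (trans (sym (punchIn-punchedTo y)) e) , refl-at φ (punchIn-punchedTo x) refl h))

≼-resp-≅ : ∀ {m n} {H : Graph m} {G G′ : Graph n} → H ≼ G → G ≅ G′ → H ≼ G′
≼-resp-≅ (iso ψ) φ = iso (≅-trans (≅-sym φ) ψ)
≼-resp-≅ (delV v d) φ = delV (to φ v) (≼-resp-≅ d (deleteVertex-≅ φ v))
≼-resp-≅ (delE u v e d) φ = delE (to φ u) (to φ v) (pres φ u v e) (≼-resp-≅ d (deleteEdge-≅ φ u v))
≼-resp-≅ (contr u v u≢v e d) φ =
  contr (to φ u) (to φ v) (λ eq → u≢v (to-injective φ eq)) (pres φ u v e) (≼-resp-≅ d (contract-≅ φ v u))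

IsComplete : ∀ {n} → Graph n → Set
IsComplete {n} G = ∀ (x y : Fin n) → (x ≢ y → G x y) × (G x y → x ≢ y)

isComplete? : ∀ {n} {G : Graph n} → Decidable G → Dec (IsComplete G)
isComplete? G? = all? λ x → all? λ y → (¬? (x ≟ᶠ y) →-dec G? x y) ×-dec (G? x y →-dec ¬? (x ≟ᶠ y))

complete-≅-K : ∀ {n} {G : Graph n} → IsComplete G → G ≅ K n
complete-≅-K complete = record
  { to = λ x → x ; from = λ x → x ; from-to = λ _ → refl ; to-from = λ _ → refl
  ; pres = λ x y → proj₂ (complete x y)
  ; refl' = λ x y → proj₁ (complete x y)
  }

deleteVertex? : ∀ {n} {G : Graph (suc n)} → Decidable G → ∀ v → Decidable (deleteVertex G v)
deleteVertex? G? v x y = G? (punchIn v x) (punchIn v y)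

contract? : ∀ {n} {G : Graph (suc n)} → Decidable G → ∀ u v → Decidable (contract G u v)
contract? {n} G? u v i j =
  ¬? (i ≟ᶠ j) ×-dec (G? a b ⊎-dec (((a ≟ᶠ u) ×-dec G? v b) ⊎-dec ((b ≟ᶠ u) ×-dec G? a v)))
  where
  a b : Fin (suc n)
  a = punchIn v i
  b = punchIn v j

complement? : ∀ {n} {G : Graph n} → Decidable G → Decidable (complement G)
complement? G? x y = ¬? (x ≟ᶠ y) ×-dec ¬? (G? x y)

elongatedPrism? : ∀ a b c → Decidable (ElongatedPrism a b c)
elongatedPrism? a b c x y = (_ ∈? prismEdges a b c) ⊎-dec (_ ∈? prismEdges a b c)

data MinorScript : ℕ → Set where
  done : MinorScript 7
  del  : ∀ {n} → Fin (suc n) → MinorScript n → MinorScript (suc n)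
  con  : ∀ {n} → Fin (suc n) → Fin (suc n) → MinorScript n → MinorScript (suc n)

Valid : ∀ {n} (G : Graph n) → Decidable G → MinorScript n → Set
Valid G G? done = True (isComplete? G?)
Valid G G? (del v s) = Valid (deleteVertex G v) (deleteVertex? G? v) s
Valid G G? (con u v s) = True (G? u v) × True (¬? (u ≟ᶠ v)) × Valid (contract G u v) (contract? G? u v) s

valid⇒K₇≼ : ∀ {n} {G : Graph n} (G? : Decidable G) (s : MinorScript n) → {Valid G G? s} → K 7 ≼ G
valid⇒K₇≼ G? done {valid} = iso (complete-≅-K (toWitness valid))
valid⇒K₇≼ G? (del v s) {valid} = delV v (valid⇒K₇≼ (deleteVertex? G? v) s {valid})
valid⇒K₇≼ G? (con u v s) {uv , u≢v , valid} =
  contr u v (toWitness u≢v) (toWitness uv) (valid⇒K₇≼ (contract? G? u v) s {valid})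

K₇≼complement-prism-by : ∀ a b c {G : Graph (6 + a + b + c)} (s : MinorScript (6 + a + b + c)) →
  {Valid (complement (ElongatedPrism a b c)) (complement? (elongatedPrism? a b c)) s} →
  ElongatedPrism a b c ≅ G → K 7 ≼ complement G
K₇≼complement-prism-by a b c s {valid} φ =
  ≼-resp-≅ (valid⇒K₇≼ (complement? (elongatedPrism? a b c)) s {valid}) (complement-≅ φ)

K₇≼complement-prism₁₁ : ∀ a b c → 6 + a + b + c ≡ 11 →
  {G : Graph 11} → ElongatedPrism a b c ≅ G → K 7 ≼ complement G
K₇≼complement-prism₁₁ 0 0 5 refl =
  K₇≼complement-prism-by 0 0 5 (con (# 9) (# 1) (con (# 6) (# 9) (con (# 2) (# 6) (con (# 4) (# 1) done))))
K₇≼complement-prism₁₁ 0 1 4 refl =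
  K₇≼complement-prism-by 0 1 4 (con (# 2) (# 10) (del (# 4) (con (# 8) (# 3) (con (# 1) (# 5) done))))
K₇≼complement-prism₁₁ 0 2 3 refl =
  K₇≼complement-prism-by 0 2 3 (con (# 9) (# 0) (con (# 2) (# 5) (con (# 4) (# 5) (con (# 4) (# 1) done))))
K₇≼complement-prism₁₁ 0 3 2 refl =
  K₇≼complement-prism-by 0 3 2 (con (# 4) (# 6) (con (# 4) (# 3) (con (# 0) (# 8) (con (# 2) (# 6) done))))
K₇≼complement-prism₁₁ 0 4 1 refl =
  K₇≼complement-prism-by 0 4 1 (con (# 9) (# 0) (con (# 0) (# 3) (del (# 3) (con (# 7) (# 4) done))))
K₇≼complement-prism₁₁ 0 5 0 refl =
  K₇≼complement-prism-by 0 5 0 (con (# 2) (# 3) (del (# 3) (con (# 7) (# 1) (con (# 1) (# 4) done))))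
K₇≼complement-prism₁₁ 1 0 4 refl =
  K₇≼complement-prism-by 1 0 4 (con (# 3) (# 2) (con (# 6) (# 0) (con (# 7) (# 0) (con (# 2) (# 0) done))))
K₇≼complement-prism₁₁ 1 1 3 refl =
  K₇≼complement-prism-by 1 1 3 (con (# 9) (# 1) (con (# 2) (# 8) (con (# 7) (# 4) (con (# 3) (# 0) done))))
K₇≼complement-prism₁₁ 1 2 2 refl =
  K₇≼complement-prism-by 1 2 2 (con (# 1) (# 5) (con (# 2) (# 6) (con (# 4) (# 8) (con (# 5) (# 2) done))))
K₇≼complement-prism₁₁ 1 3 1 refl =
  K₇≼complement-prism-by 1 3 1 (del (# 8) (con (# 1) (# 9) (con (# 1) (# 3) (con (# 3) (# 0) done))))
K₇≼complement-prism₁₁ 1 4 0 refl =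
  K₇≼complement-prism-by 1 4 0 (con (# 1) (# 10) (con (# 5) (# 0) (con (# 2) (# 4) (con (# 6) (# 2) done))))
K₇≼complement-prism₁₁ 2 0 3 refl =
  K₇≼complement-prism-by 2 0 3 (con (# 6) (# 2) (con (# 2) (# 1) (con (# 7) (# 2) (con (# 3) (# 2) done))))
K₇≼complement-prism₁₁ 2 1 2 refl =
  K₇≼complement-prism-by 2 1 2 (con (# 9) (# 1) (con (# 6) (# 8) (del (# 3) (con (# 0) (# 3) done))))
K₇≼complement-prism₁₁ 2 2 1 refl =
  K₇≼complement-prism-by 2 2 1 (con (# 10) (# 8) (con (# 9) (# 3) (con (# 6) (# 2) (con (# 2) (# 0) done))))
K₇≼complement-prism₁₁ 2 3 0 refl =
  K₇≼complement-prism-by 2 3 0 (con (# 10) (# 3) (con (# 9) (# 5) (con (# 3) (# 1) (con (# 1) (# 6) done))))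
K₇≼complement-prism₁₁ 3 0 2 refl =
  K₇≼complement-prism-by 3 0 2 (con (# 8) (# 10) (con (# 7) (# 0) (con (# 4) (# 1) (con (# 4) (# 2) done))))
K₇≼complement-prism₁₁ 3 1 1 refl =
  K₇≼complement-prism-by 3 1 1 (con (# 1) (# 4) (con (# 7) (# 5) (con (# 4) (# 6) (con (# 1) (# 2) done))))
K₇≼complement-prism₁₁ 3 2 0 refl =
  K₇≼complement-prism-by 3 2 0 (con (# 2) (# 4) (con (# 0) (# 4) (con (# 3) (# 2) (con (# 4) (# 6) done))))
K₇≼complement-prism₁₁ 4 0 1 refl =
  K₇≼complement-prism-by 4 0 1 (con (# 6) (# 5) (con (# 5) (# 8) (con (# 7) (# 1) (con (# 1) (# 2) done))))
K₇≼complement-prism₁₁ 4 1 0 refl =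
  K₇≼complement-prism-by 4 1 0 (con (# 1) (# 6) (con (# 2) (# 4) (con (# 6) (# 4) (con (# 1) (# 6) done))))
K₇≼complement-prism₁₁ 5 0 0 refl =
  K₇≼complement-prism-by 5 0 0 (con (# 6) (# 9) (con (# 3) (# 1) (con (# 0) (# 3) (con (# 1) (# 5) done))))

lemma7 : (G : Graph 11) → IsElongatedPrism G → K 7 ≼ complement G
lemma7 G (a , b , c , φ) =
  K₇≼complement-prism₁₁ a b c vertexCount φ
  where
  vertexCount : 6 + a + b + c ≡ 11
  vertexCount = cantor-schröder-bernstein (to-injective φ) (from-injective φ)
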